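{- Let $a_1,a_2,\dots$ be a fixed sequence of positive integers and let $\gamma_k(l)$ be defined as in the context. Then for every $n\ge 4$, $$\gamma_n(l)=\begin{cases} a_n\gamma_{n-1}(l-1)+\gamma_{n-2}(l) & \text{if } 1\le l\le n-2,\\ a_n\gamma_{n-1}(l-1) & \text{if } l\in\{n-1,n\}.\end{cases}$$
   Context: For a positive integer $k$ let $[k]=\{1,\dots,k\}$ and, for $1\le l\le k$, let $I_{k,l}$ be the set of strictly increasing sequences $(t_1,\dots,t_l)$ of elements of $[k]$ such that $t_i\equiv k+i-l \pmod 2$ for every $i$ (so consecutive terms alternate in parity and the last term has the parity of $k$). For $\mathbf t=(t_1,\dots,t_l)$ write $a_{\mathbf t}=a_{t_1}a_{t_2}\cdots a_{t_l}$. Define $\gamma_k(l)=\sum_{\mathbf t\in I_{k,l}}a_{\mathbf t}$ for $1\le l\le k$, and $\gamma_k(0)=1$. -}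

module Defs where

open import Data.Nat using (ℕ; zero; suc; _+_; _*_; _%_; _≡ᵇ_)
open import Data.Bool using (Bool; true; false; _∧_)
open import Data.List using (List; []; _∷_; _++_; map; filterᵇ; length; _∷ʳ_)
open import Data.Nat.ListAction using (sum; product)

-- All strictly increasing sequences of elements of [k] = {1,…,k}
-- (i.e. all subsets of [k], listed in increasing order).
incSeqs : ℕ → List (List ℕ)
incSeqs zero    = [] ∷ []
incSeqs (suc k) = incSeqs k ++ map (_∷ʳ suc k) (incSeqs k)

-- Parity condition  t_i ≡ k + i - l (mod 2)  for positions i = i₀, i₀+1, …
-- checked in the equivalent subtraction-free form  t_i + l ≡ k + i (mod 2).
parityOK : ℕ → ℕ → ℕ → List ℕ → Bool
parityOK k l i []       = true
parityOK k l i (t ∷ ts) = (((t + l) % 2) ≡ᵇ ((k + i) % 2)) ∧ parityOK k l (suc i) ts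

I : ℕ → ℕ → List (List ℕ)
I k l = filterᵇ (λ t → (length t ≡ᵇ l) ∧ parityOK k l 1 t) (incSeqs k)

aProd : (ℕ → ℕ) → List ℕ → ℕ
aProd a t = product (map a t)

γ : (ℕ → ℕ) → ℕ → ℕ → ℕ
γ a k zero    = 1
γ a k (suc l) = sum (map (aProd a) (I k (suc l)))

-- A sequence in I_{k+2,m+1} either ends at k+2, and removing that term is a bijection onto
-- I_{k+1,m} (dropping the last position and lowering both k and l by one keeps every parity
-- condition); or ends at k+1, which is impossible since the last term has the parity of k+2;
-- or lies in [k], where the parity conditions for k+2 and for k coincide, giving I_{k,m+1}.
-- Hence γ_{k+2}(m+1) = a_{k+2} γ_{k+1}(m) + γ_k(m+1), and for l ∈ {n-1, n} the last summand
-- γ_{n-2}(l) vanishes because [n-2] has no l-element subsets.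
module Submission where

open import Defs
open import Data.Bool using (Bool; true; false; T; _∧_)
open import Data.Bool.Properties using (∧-assoc; ∧-identityʳ; ∧-zeroʳ; T-≡)
open import Data.List using (List; []; _∷_; [_]; _++_; _∷ʳ_; map; filterᵇ; length)
open import Data.List.Properties using (filter-++; map-++; length-++)
open import Data.Nat using (ℕ; zero; suc; _+_; _*_; _∸_; _%_; _≡ᵇ_; _≤_; _<_; s≤s; z≤n)
open import Data.Nat.DivMod using (m%n<n)
open import Data.Nat.ListAction using (sum; product)
open import Data.Nat.ListAction.Properties using (sum-++; product-++)
open import Data.Nat.Properties
  using (+-comm; +-suc; +-identityʳ; *-comm; *-identityʳ; *-distribʳ-+
        ; ≡ᵇ⇒≡; ≡⇒≡ᵇ; n<1+n; m<n⇒m<1+n; <-trans)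
open import Data.Product using (_×_; _,_)
open import Data.Sum using (_⊎_; inj₁; inj₂)
open import Function using (_∘_; Equivalence)
open import Relation.Binary.PropositionalEquality
  using (_≡_; refl; sym; trans; cong; cong₂; subst; module ≡-Reasoning)
open import Relation.Nullary.Decidable using (T?)

sumWhere : {A : Set} → (A → Bool) → (A → ℕ) → List A → ℕ
sumWhere P g xs = sum (map g (filterᵇ P xs))

module _ {A : Set} where

  sumWhere-++ : ∀ (P : A → Bool) g xs ys →
                sumWhere P g (xs ++ ys) ≡ sumWhere P g xs + sumWhere P g ys
  sumWhere-++ P g xs ys = begin
    sum (map g (filterᵇ P (xs ++ ys)))                    ≡⟨ cong (sum ∘ map g) (filter-++ (T? ∘ P) xs ys) ⟩
    sum (map g (filterᵇ P xs ++ filterᵇ P ys))            ≡⟨ cong sum (map-++ g (filterᵇ P xs) _) ⟩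
    sum (map g (filterᵇ P xs) ++ map g (filterᵇ P ys))    ≡⟨ sum-++ (map g (filterᵇ P xs)) _ ⟩
    sumWhere P g xs + sumWhere P g ys                     ∎
    where open ≡-Reasoning

  sumWhere-map : ∀ {B : Set} (P : B → Bool) g (f : A → B) xs →
                 sumWhere P g (map f xs) ≡ sumWhere (P ∘ f) (g ∘ f) xs
  sumWhere-map P g f []       = refl
  sumWhere-map P g f (x ∷ xs) with P (f x)
  ... | true  = cong (g (f x) +_) (sumWhere-map P g f xs)
  ... | false = sumWhere-map P g f xs

  sumWhere-cong : ∀ {P Q : A → Bool} {g h : A → ℕ} →
                  (∀ x → P x ≡ Q x) → (∀ x → g x ≡ h x) → ∀ xs → sumWhere P g xs ≡ sumWhere Q h xs
  sumWhere-cong             P≗Q g≗h []       = refl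
  sumWhere-cong {P} {Q} {g} P≗Q g≗h (x ∷ xs) with P x | Q x | P≗Q x
  ... | true  | true  | _ = cong₂ _+_ (g≗h x) (sumWhere-cong P≗Q g≗h xs)
  ... | false | false | _ = sumWhere-cong P≗Q g≗h xs

  sumWhere-*ʳ : ∀ (P : A → Bool) g c xs → sumWhere P (λ x → g x * c) xs ≡ sumWhere P g xs * c
  sumWhere-*ʳ P g c []       = refl
  sumWhere-*ʳ P g c (x ∷ xs) with P x
  ... | true  = trans (cong (g x * c +_) (sumWhere-*ʳ P g c xs)) (sym (*-distribʳ-+ c (g x) _))
  ... | false = sumWhere-*ʳ P g c xs

  sumWhere-none : ∀ {P : A → Bool} g → (∀ x → P x ≡ false) → ∀ xs → sumWhere P g xs ≡ 0
  sumWhere-none {P} g ¬P xs = trans (sumWhere-cong ¬P (λ _ → refl) xs) (none xs)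
    where
    none : ∀ xs → sumWhere (λ _ → false) g xs ≡ 0
    none []       = refl
    none (_ ∷ xs) = none xs

sumWhere-incSeqs-suc : ∀ (P : List ℕ → Bool) g k →
  sumWhere P g (incSeqs (suc k)) ≡
  sumWhere P g (incSeqs k) + sumWhere (P ∘ (_∷ʳ suc k)) (g ∘ (_∷ʳ suc k)) (incSeqs k)
sumWhere-incSeqs-suc P g k =
  trans (sumWhere-++ P g (incSeqs k) _)
        (cong (sumWhere P g (incSeqs k) +_) (sumWhere-map P g (_∷ʳ suc k) (incSeqs k)))

length-∷ʳ : ∀ {A : Set} (xs : List A) x → length (xs ∷ʳ x) ≡ suc (length xs)
length-∷ʳ xs x = trans (length-++ xs) (+-comm (length xs) 1)

sumWhere-incSeqs-empty : ∀ (Q : List ℕ → Bool) (g : List ℕ → ℕ) k →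
  sumWhere (λ t → (length t ≡ᵇ 0) ∧ Q t) g (incSeqs k) ≡
  sumWhere (λ t → (length t ≡ᵇ 0) ∧ Q t) g ([] ∷ [])
sumWhere-incSeqs-empty Q g zero    = refl
sumWhere-incSeqs-empty Q g (suc k) = begin
  sumWhere P g (incSeqs (suc k))
    ≡⟨ sumWhere-incSeqs-suc P g k ⟩
  sumWhere P g (incSeqs k) + sumWhere (P ∘ (_∷ʳ suc k)) _ (incSeqs k)
    ≡⟨ cong₂ _+_ (sumWhere-incSeqs-empty Q g k) (sumWhere-none _ nonEmpty (incSeqs k)) ⟩
  sumWhere P g ([] ∷ []) + 0
    ≡⟨ +-identityʳ _ ⟩
  sumWhere P g ([] ∷ []) ∎
  where
  open ≡-Reasoning
  P = λ t → (length t ≡ᵇ 0) ∧ Q t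
  nonEmpty : ∀ t → P (t ∷ʳ suc k) ≡ false
  nonEmpty t rewrite length-∷ʳ t (suc k) = refl

sumWhere-incSeqs-long : ∀ (Q : List ℕ → Bool) (g : List ℕ → ℕ) k l → k < l →
  sumWhere (λ t → (length t ≡ᵇ l) ∧ Q t) g (incSeqs k) ≡ 0
sumWhere-incSeqs-long Q g zero    (suc l) _         = refl
sumWhere-incSeqs-long Q g (suc k) (suc l) (s≤s k<l) = begin
  sumWhere P g (incSeqs (suc k))
    ≡⟨ sumWhere-incSeqs-suc P g k ⟩
  sumWhere P g (incSeqs k) + sumWhere (P ∘ (_∷ʳ suc k)) (g ∘ (_∷ʳ suc k)) (incSeqs k)
    ≡⟨ cong₂ _+_ (sumWhere-incSeqs-long Q g k (suc l) (m<n⇒m<1+n k<l))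
                 (trans (sumWhere-cong shorter (λ _ → refl) (incSeqs k))
                        (sumWhere-incSeqs-long (Q ∘ (_∷ʳ suc k)) (g ∘ (_∷ʳ suc k)) k l k<l)) ⟩
  0 ∎
  where
  open ≡-Reasoning
  P = λ t → (length t ≡ᵇ suc l) ∧ Q t
  shorter : ∀ t → P (t ∷ʳ suc k) ≡ ((length t ≡ᵇ l) ∧ Q (t ∷ʳ suc k))
  shorter t rewrite length-∷ʳ t (suc k) = refl

%2-suc : ∀ n → suc n % 2 ≡ 1 ∸ n % 2
%2-suc zero          = refl
%2-suc (suc zero)    = refl
%2-suc (suc (suc n)) = %2-suc n

sameParity-suc : ∀ m n → (suc m % 2 ≡ᵇ suc n % 2) ≡ (m % 2 ≡ᵇ n % 2)
sameParity-suc m n rewrite %2-suc m | %2-suc n = bit-flip (m%n<n m 2) (m%n<n n 2)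
  where
  bit-flip : ∀ {x y} → x < 2 → y < 2 → ((1 ∸ x) ≡ᵇ (1 ∸ y)) ≡ (x ≡ᵇ y)
  bit-flip (s≤s z≤n)       (s≤s z≤n)       = refl
  bit-flip (s≤s z≤n)       (s≤s (s≤s z≤n)) = refl
  bit-flip (s≤s (s≤s z≤n)) (s≤s z≤n)       = refl
  bit-flip (s≤s (s≤s z≤n)) (s≤s (s≤s z≤n)) = refl

sameParity-suc-false : ∀ n → (n % 2 ≡ᵇ suc n % 2) ≡ false
sameParity-suc-false n rewrite %2-suc n = bit-differs (m%n<n n 2)
  where
  bit-differs : ∀ {x} → x < 2 → (x ≡ᵇ 1 ∸ x) ≡ false
  bit-differs (s≤s z≤n)       = refl
  bit-differs (s≤s (s≤s z≤n)) = refl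

≡ᵇ-refl : ∀ n → (n ≡ᵇ n) ≡ true
≡ᵇ-refl n = Equivalence.to T-≡ (≡⇒≡ᵇ n n refl)

parityOK-+2 : ∀ k l i t → parityOK (suc (suc k)) l i t ≡ parityOK k l i t
parityOK-+2 k l i []      = refl
parityOK-+2 k l i (x ∷ t) = cong (_ ∧_) (parityOK-+2 k l (suc i) t)

parityOK-suc : ∀ k l i t → parityOK (suc k) (suc l) i t ≡ parityOK k l i t
parityOK-suc k l i []      = refl
parityOK-suc k l i (x ∷ t) rewrite +-suc x l =
  cong₂ _∧_ (sameParity-suc (x + l) (k + i)) (parityOK-suc k l (suc i) t)

parityOK-∷ʳ : ∀ k l i t x →
  parityOK k l i (t ∷ʳ x) ≡ (parityOK k l i t ∧ ((x + l) % 2 ≡ᵇ (k + (i + length t)) % 2))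
parityOK-∷ʳ k l i []      x rewrite +-identityʳ i = ∧-identityʳ _
parityOK-∷ʳ k l i (y ∷ t) x rewrite parityOK-∷ʳ k l (suc i) t x | +-suc i (length t) =
  sym (∧-assoc ((y + l) % 2 ≡ᵇ (k + i) % 2) _ _)

∧-cong-≡ᵇ : ∀ m n {x y : Bool} → (m ≡ n → x ≡ y) → ((m ≡ᵇ n) ∧ x) ≡ ((m ≡ᵇ n) ∧ y)
∧-cong-≡ᵇ m n x≡y with m ≡ᵇ n in eq
... | false = refl
... | true  = x≡y (≡ᵇ⇒≡ m n (subst T (sym eq) _))

inI : ℕ → ℕ → List ℕ → Bool
inI k l t = (length t ≡ᵇ l) ∧ parityOK k l 1 t

inI-+2 : ∀ k l t → inI (suc (suc k)) l t ≡ inI k l t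
inI-+2 k l t = cong (_ ∧_) (parityOK-+2 k l 1 t)

inI-∷ʳ-top : ∀ k m t → inI (suc (suc k)) (suc m) (t ∷ʳ suc (suc k)) ≡ inI (suc k) m t
inI-∷ʳ-top k m t
  rewrite length-∷ʳ t (suc (suc k))
        | parityOK-∷ʳ (suc (suc k)) (suc m) 1 t (suc (suc k))
        | parityOK-suc (suc k) m 1 t
        = ∧-cong-≡ᵇ (length t) m lastOK
  where
  lastOK : length t ≡ m → (parityOK (suc k) m 1 t ∧ _) ≡ parityOK (suc k) m 1 t
  lastOK refl =
    trans (cong (parityOK (suc k) m 1 t ∧_) (≡ᵇ-refl (suc (suc (k + suc m)) % 2))) (∧-identityʳ _)

inI-∷ʳ-belowTop : ∀ k m t → inI (suc (suc k)) (suc m) (t ∷ʳ suc k) ≡ false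
inI-∷ʳ-belowTop k m t
  rewrite length-∷ʳ t (suc k)
        | parityOK-∷ʳ (suc (suc k)) (suc m) 1 t (suc k)
        = trans (∧-cong-≡ᵇ (length t) m lastFails) (∧-zeroʳ _)
  where
  lastFails : length t ≡ m → (parityOK (suc (suc k)) (suc m) 1 t ∧ _) ≡ false
  lastFails refl =
    trans (cong (parityOK (suc (suc k)) (suc m) 1 t ∧_) (sameParity-suc-false (suc (k + suc m))))
          (∧-zeroʳ _)

aProd-∷ʳ : ∀ (a : ℕ → ℕ) t x → aProd a (t ∷ʳ x) ≡ aProd a t * a x
aProd-∷ʳ a t x = begin
  product (map a (t ++ [ x ]))    ≡⟨ cong product (map-++ a t [ x ]) ⟩
  product (map a t ++ [ a x ])    ≡⟨ product-++ (map a t) [ a x ] ⟩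
  aProd a t * (a x * 1)           ≡⟨ cong (aProd a t *_) (*-identityʳ (a x)) ⟩
  aProd a t * a x                 ∎
  where open ≡-Reasoning

module _ (a : ℕ → ℕ) where

  γ-sumWhere : ∀ k l → γ a k l ≡ sumWhere (inI k l) (aProd a) (incSeqs k)
  γ-sumWhere k zero    = sym (sumWhere-incSeqs-empty (parityOK k 0 1) (aProd a) k)
  γ-sumWhere k (suc l) = refl

  γ-vanishes : ∀ k l → k < l → γ a k l ≡ 0
  γ-vanishes k (suc l) k<l = sumWhere-incSeqs-long (parityOK k (suc l) 1) (aProd a) k (suc l) k<l

  γ-rec : ∀ k m → γ a (suc (suc k)) (suc m) ≡ a (suc (suc k)) * γ a (suc k) m + γ a k (suc m)
  γ-rec k m = begin
    sumWhere P g (incSeqs (suc (suc k)))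
      ≡⟨ sumWhere-incSeqs-suc P g (suc k) ⟩
    sumWhere P g (incSeqs (suc k)) + sumWhere (P ∘ (_∷ʳ n)) (g ∘ (_∷ʳ n)) (incSeqs (suc k))
      ≡⟨ cong (_+ sumWhere (P ∘ (_∷ʳ n)) (g ∘ (_∷ʳ n)) (incSeqs (suc k))) (sumWhere-incSeqs-suc P g k) ⟩
    (sumWhere P g (incSeqs k) + sumWhere (P ∘ (_∷ʳ suc k)) (g ∘ (_∷ʳ suc k)) (incSeqs k))
      + sumWhere (P ∘ (_∷ʳ n)) (g ∘ (_∷ʳ n)) (incSeqs (suc k))
      ≡⟨ cong₂ _+_ (cong₂ _+_ inside endingBelowTop) endingTop ⟩
    (γ a k (suc m) + 0) + γ a (suc k) m * a n
      ≡⟨ cong₂ _+_ (+-identityʳ _) (*-comm _ (a n)) ⟩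
    γ a k (suc m) + a n * γ a (suc k) m
      ≡⟨ +-comm (γ a k (suc m)) _ ⟩
    a n * γ a (suc k) m + γ a k (suc m) ∎
    where
    open ≡-Reasoning
    n = suc (suc k)
    P = inI n (suc m)
    g = aProd a

    inside : sumWhere P g (incSeqs k) ≡ γ a k (suc m)
    inside = sumWhere-cong (inI-+2 k (suc m)) (λ _ → refl) (incSeqs k)

    endingBelowTop : sumWhere (P ∘ (_∷ʳ suc k)) (g ∘ (_∷ʳ suc k)) (incSeqs k) ≡ 0
    endingBelowTop = sumWhere-none _ (inI-∷ʳ-belowTop k m) (incSeqs k)

    endingTop : sumWhere (P ∘ (_∷ʳ n)) (g ∘ (_∷ʳ n)) (incSeqs (suc k)) ≡ γ a (suc k) m * a n
    endingTop = begin
      sumWhere (P ∘ (_∷ʳ n)) (g ∘ (_∷ʳ n)) (incSeqs (suc k))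
        ≡⟨ sumWhere-cong (inI-∷ʳ-top k m) (λ t → aProd-∷ʳ a t n) (incSeqs (suc k)) ⟩
      sumWhere (inI (suc k) m) (λ t → g t * a n) (incSeqs (suc k))
        ≡⟨ sumWhere-*ʳ (inI (suc k) m) g (a n) (incSeqs (suc k)) ⟩
      sumWhere (inI (suc k) m) g (incSeqs (suc k)) * a n
        ≡⟨ cong (_* a n) (sym (γ-sumWhere (suc k) m)) ⟩
      γ a (suc k) m * a n ∎

lemma1 : (a : ℕ → ℕ) → (∀ i → 1 ≤ i → 0 < a i) →
           ∀ n → 4 ≤ n → ∀ l →
             ((1 ≤ l → l ≤ n ∸ 2 → γ a n l ≡ a n * γ a (n ∸ 1) (l ∸ 1) + γ a (n ∸ 2) l)
             × (l ≡ n ∸ 1 ⊎ l ≡ n → γ a n l ≡ a n * γ a (n ∸ 1) (l ∸ 1)))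
lemma1 a _ (suc (suc k)) (s≤s (s≤s _)) l = interior l , boundary l
  where
  interior : ∀ l → 1 ≤ l → l ≤ k →
             γ a (suc (suc k)) l ≡ a (suc (suc k)) * γ a (suc k) (l ∸ 1) + γ a k l
  interior (suc m) _ _ = γ-rec a k m

  boundary : ∀ l → l ≡ suc k ⊎ l ≡ suc (suc k) →
             γ a (suc (suc k)) l ≡ a (suc (suc k)) * γ a (suc k) (l ∸ 1)
  boundary l (inj₁ refl) rewrite γ-rec a k k | γ-vanishes a k (suc k) (n<1+n k) = +-identityʳ _
  boundary l (inj₂ refl)
    rewrite γ-rec a k (suc k)
          | γ-vanishes a k (suc (suc k)) (<-trans (n<1+n k) (n<1+n (suc k)))
          = +-identityʳ _
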